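{- Let $\mathcal{U}$ be a universe of worlds, let $W \in \mathcal{U}$, and let $\leq_W$ be a comparative similarity relation on $\mathcal{U}$ that is a total order. Then for all properties $\varphi$ and $\psi$, the `Existential Might' counterfactual $\varphi \,\Diamond\!\!\to_{\exists}\, \psi$ and Lewis' `Might' counterfactual $\varphi \,\Diamond\!\!\to\, \psi$ are equivalent, i.e. $W \models \varphi \,\Diamond\!\!\to_{\exists}\, \psi$ iff $W \models \varphi \,\Diamond\!\!\to\, \psi$.
   Context: A universe is a set $\mathcal{U}$ of worlds; properties are formulas of some logic with a satisfaction relation $W \models \varphi$. All quantifiers over worlds range over $\mathcal{U}$. A comparative similarity relation for reference world $W$ is a preorder $\leq_W$ on $\mathcal{U}$ with $W$ as its minimum; $W_1 \leq_W W_2$ means $W_1$ is at least as close to $W$ as $W_2$. `Might': $W \models \varphi \,\Diamond\!\!\to\, \psi$ iff (1) $\exists W_1.\ W_1 \models \varphi$, and (2) $\forall W_1.\ \big(W_1 \models \varphi \Rightarrow \exists W_2.\ W_2 \leq_W W_1 \wedge W_2 \models \varphi \wedge \psi\big)$. `Existential Might': $W \models \varphi \,\Diamond\!\!\to_{\exists}\, \psi$ iff $\exists W_1.\ W_1 \models \varphi \wedge \forall W_2.\ \big(W_2 \leq_W W_1 \wedge W_2 \models \varphi \Rightarrow \exists W_3.\ W_3 \leq_W W_2 \wedge W_3 \models \varphi \wedge \psi\big)$. -}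

module Defs where

open import Level using (Level; _⊔_)
open import Relation.Binary.Core using (Rel)
open import Relation.Binary.Structures using (IsPreorder)
open import Relation.Binary.PropositionalEquality using (_≡_)
open import Data.Product using (_×_; ∃)

-- A universe U of worlds, a type Formula of properties, and a satisfaction
-- relation _⊨_ : U → Formula → Set s.  The conjunction φ ∧ ψ is interpreted
-- via satisfaction of both conjuncts.

record IsComparativeSimilarity {u r : Level} {U : Set u}
         (W : U) (_≤_ : Rel U r) : Set (u ⊔ r) where
  field
    isPreorder : IsPreorder _≡_ _≤_
    minimum    : ∀ V → W ≤ V

Might : {u r s f : Level} {U : Set u} {Formula : Set f}
        (_⊨_ : U → Formula → Set s) (_≤W_ : Rel U r) (φ ψ : Formula) →
        Set (u ⊔ r ⊔ s)
Might {U = U} _⊨_ _≤W_ φ ψ =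
  (∃ λ (W₁ : U) → W₁ ⊨ φ) ×
  (∀ (W₁ : U) → W₁ ⊨ φ → ∃ λ (W₂ : U) → W₂ ≤W W₁ × (W₂ ⊨ φ × W₂ ⊨ ψ))

ExistentialMight : {u r s f : Level} {U : Set u} {Formula : Set f}
        (_⊨_ : U → Formula → Set s) (_≤W_ : Rel U r) (φ ψ : Formula) →
        Set (u ⊔ r ⊔ s)
ExistentialMight {U = U} _⊨_ _≤W_ φ ψ =
  ∃ λ (W₁ : U) → W₁ ⊨ φ ×
    (∀ (W₂ : U) → W₂ ≤W W₁ → W₂ ⊨ φ →
       ∃ λ (W₃ : U) → W₃ ≤W W₂ × (W₃ ⊨ φ × W₃ ⊨ ψ))

{-# OPTIONS --safe #-}
module Submission where

open import Defs
open import Level using (Level)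
open import Relation.Binary.Core using (Rel)
open import Relation.Binary.Structures using (IsTotalOrder; IsTotalPreorder)
open import Relation.Binary.PropositionalEquality using (_≡_)
open import Function.Bundles using (_⇔_; mk⇔)
open import Data.Product using (_,_; _×_; ∃)
open import Data.Sum using (inj₁; inj₂)

-- Might always gives Existential Might with the same φ-world. Conversely, a φ-world V is
-- either closer than the witness W₁, where Existential Might applies directly, or farther,
-- where the ψ-world found below W₁ is also below V.

module _ {u r s f : Level} {U : Set u} {Formula : Set f}
         (_⊨_ : U → Formula → Set s) {_≤_ : Rel U r} where

  Might⇒ExistentialMight : ∀ φ ψ → Might _⊨_ _≤_ φ ψ → ExistentialMight _⊨_ _≤_ φ ψ
  Might⇒ExistentialMight φ ψ ((W₁ , W₁⊨φ) , might) =
    W₁ , W₁⊨φ , λ W₂ _ W₂⊨φ → might W₂ W₂⊨φ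

  ExistentialMight⇒Might : {e : Level} {_≈_ : Rel U e} → IsTotalPreorder _≈_ _≤_ →
                           ∀ φ ψ → ExistentialMight _⊨_ _≤_ φ ψ → Might _⊨_ _≤_ φ ψ
  ExistentialMight⇒Might totalPreorder φ ψ (W₁ , W₁⊨φ , closer) =
    (W₁ , W₁⊨φ) , λ V V⊨φ → closer-than V V⊨φ
    where
    open IsTotalPreorder totalPreorder using (total; refl; trans)
    closer-than : ∀ V → V ⊨ φ → ∃ λ W₂ → W₂ ≤ V × (W₂ ⊨ φ × W₂ ⊨ ψ)
    closer-than V V⊨φ with total V W₁
    ... | inj₁ V≤W₁ = closer V V≤W₁ V⊨φ
    ... | inj₂ W₁≤V with closer W₁ refl W₁⊨φ
    ...   | W₃ , W₃≤W₁ , W₃⊨φψ = W₃ , trans W₃≤W₁ W₁≤V , W₃⊨φψ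

corollary11 : {u r s f : Level} (U : Set u) (Formula : Set f)
    (_⊨_ : U → Formula → Set s) (W : U) (_≤W_ : Rel U r) →
    IsComparativeSimilarity W _≤W_ →
    IsTotalOrder _≡_ _≤W_ →
    (φ ψ : Formula) →
    ExistentialMight _⊨_ _≤W_ φ ψ ⇔ Might _⊨_ _≤W_ φ ψ
corollary11 U Formula _⊨_ W _≤W_ _ totalOrder φ ψ =
  mk⇔ (ExistentialMight⇒Might _⊨_ (IsTotalOrder.isTotalPreorder totalOrder) φ ψ)
      (Might⇒ExistentialMight _⊨_ φ ψ)
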